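{- Let $\theta\in\mathbb{F}_q((1/t))$, let $\ell>0$ be an integer, and let $(i_m)_{m\ge0},(j_m)_{m\ge0}$ be the index sequences associated with $\theta$ and $\ell$. If $j_{m+1}<\infty$ for some $m\geq0$, then the minimum defining $i_{m+1}$ exists (so $i_{m+1}$ is well defined), and (1) $i_{m+1}\leq j_{m+1}+\ell$; (2) $i_{m+1}\geq i_m+\ell$; (3) $j_{m+1}\geq j_m+\ell$.
   Context: $\mathbb{F}_q((1/t))$ is the field of Laurent series $\theta=\sum_i\theta_it^{ -i}$ over the finite field $\mathbb{F}_q$ (finitely many nonzero coefficients of positive powers of $t$). For positive integers $i,j$ let $\Delta[i,j]$ be the $i\times j$ matrix over $\mathbb{F}_q$ with $(a,b)$ entry $\theta_{a+b-1}$ (a Hankel matrix in the coefficients $\theta_1,\theta_2,\dots$). The index sequences are defined by: $j_0=0$, $i_0=\ell$; $j_{m+1}=\min\{j\ge1:\operatorname{rank}\Delta[i_m,j]=i_m\}$, with $j_{m+1}=\infty$ if no such $j$ exists; if $j_{m+1}=\infty$ then $i_{m+1}=i_m$, otherwise $i_{m+1}=\min\{i\ge1:\operatorname{rank}\Delta[i,j_{m+1}]=i-\ell\}$. -}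

module Defs where

open import Level using (0ℓ)
open import Data.Nat using (ℕ; zero; suc; _+_; _≤_; _<_)
open import Data.Integer using (ℤ; +_; -[1+_])
open import Data.Fin as Fin using (Fin; toℕ)
open import Data.Maybe using (Maybe; just; nothing)
open import Data.Product using (Σ; _×_; ∃; ∃-syntax)
open import Function.Definitions using (Injective)
open import Relation.Nullary using (¬_)
open import Relation.Binary.PropositionalEquality using (_≡_)
open import Relation.Binary.Definitions using (Decidable)
open import Algebra.Bundles using (CommutativeRing)

record FiniteField : Set₁ where
  field
    commRing  : CommutativeRing 0ℓ 0ℓ
  open CommutativeRing commRing public
  field
    _≟_       : Decidable _≈_
    0≉1       : ¬ (0# ≈ 1#)
    inverse   : ∀ x → ¬ (x ≈ 0#) → ∃[ y ] (x * y ≈ 1#)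
    q         : ℕ
    enum      : Fin q → Carrier
    enum-surj : ∀ x → ∃[ k ] (enum k ≈ x)

module _ (F : FiniteField) where
  open FiniteField F using (Carrier; _≈_; 0#; 1#)
    renaming (_+_ to _+F_; _*_ to _*F_)

  -- Laurent series θ = Σ_i θ_i t^{-i} in F_q((1/t)).
  -- coeff i = θ_i, the coefficient of t^{-i}; only finitely many
  -- coefficients of positive powers of t (i.e. negative i) are nonzero.

  record Laurent : Set where
    field
      coeff  : ℤ → Carrier
      bound  : ℕ
      finite : ∀ n → bound ≤ n → coeff -[1+ n ] ≈ 0#

  ∑ : (n : ℕ) → (Fin n → Carrier) → Carrier
  ∑ zero    f = 0#
  ∑ (suc n) f = f Fin.zero +F ∑ n (λ k → f (Fin.suc k))

  Matrix : ℕ → ℕ → Set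
  Matrix i j = Fin i → Fin j → Carrier

  RowsIndependent : ∀ {i j r} → Matrix i j → (Fin r → Fin i) → Set
  RowsIndependent {i} {j} {r} M σ =
    (c : Fin r → Carrier) →
    (∀ b → ∑ r (λ a → c a *F M (σ a) b) ≈ 0#) →
    ∀ a → c a ≈ 0#

  HasRank : ∀ {i j} → Matrix i j → ℕ → Set
  HasRank {i} M r =
    (Σ (Fin r → Fin i) λ σ → Injective _≡_ _≡_ σ × RowsIndependent M σ)
    × (∀ (τ : Fin (suc r) → Fin i) → Injective _≡_ _≡_ τ → ¬ RowsIndependent M τ)

  -- Hankel matrix Δ[i,j] with (a,b) entry θ_{a+b-1} (a,b ≥ 1);
  -- with 0-based indices a,b : Fin this is θ_{a+b+1}.
  Δ : Laurent → (i j : ℕ) → Matrix i j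
  Δ θ i j a b = Laurent.coeff θ (+ (toℕ a + toℕ b + 1))

  IsMinJ : Laurent → (i j : ℕ) → Set
  IsMinJ θ i j = 1 ≤ j × HasRank (Δ θ i j) i
               × (∀ k → 1 ≤ k → k < j → ¬ HasRank (Δ θ i k) i)

  NoJ : Laurent → (i : ℕ) → Set
  NoJ θ i = ∀ k → 1 ≤ k → ¬ HasRank (Δ θ i k) i

  -- rank Δ[i,j] = i - ℓ  (as an integer equation: requires ℓ ≤ i).
  RankCond : Laurent → (ℓ i j : ℕ) → Set
  RankCond θ ℓ i j = Σ ℕ λ r → i ≡ r + ℓ × HasRank (Δ θ i j) r

  IsMinI : Laurent → (ℓ j i : ℕ) → Set
  IsMinI θ ℓ j i = 1 ≤ i × RankCond θ ℓ i j
                 × (∀ k → 1 ≤ k → k < i → ¬ RankCond θ ℓ k j)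

  -- Reach θ ℓ m i j : (i_m, j_m) = (i, j) for the index sequences of
  -- θ and ℓ (j = nothing encodes j_m = ∞).
  data Reach (θ : Laurent) (ℓ : ℕ) : ℕ → ℕ → Maybe ℕ → Set where
    base : Reach θ ℓ 0 ℓ (just 0)
    fin  : ∀ {m i j j' i'} → Reach θ ℓ m i j →
           IsMinJ θ i j' → IsMinI θ ℓ j' i' → Reach θ ℓ (suc m) i' (just j')
    inf  : ∀ {m i j} → Reach θ ℓ m i j → NoJ θ i → Reach θ ℓ (suc m) i nothing

module Submission where

-- Write ρ(i, j) for the rank of Δ[i, j], the top-left i × j corner of the infinite matrix
-- (θ_{a+b-1}); nothing about θ beyond this corner structure is used. Gaussian elimination gives
-- every corner a row basis, and comparing spanning families (Steinitz) shows that ρ grows with i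
-- and drops by at most one per deleted row or column. Since j_{m+1} < ∞ we have
-- ρ(i_m, j_{m+1}) = i_m, while ρ(i_m, j_m) = i_m − ℓ (for m = 0 because a corner with no
-- columns has rank 0), so at least ℓ columns were added: this is (3). If ρ(k, j_{m+1}) = k − ℓ,
-- comparing the first k rows with the first i_m rows forces k ≥ i_m + ℓ: this is (2). Finally
-- k ↦ ρ(k, j_{m+1}) + ℓ is monotone, exceeds k at k = i_m and is at most k at k = j_{m+1} + ℓ,
-- so it has a least fixed point above i_m; by (2) it is i_{m+1}, and ρ(k, j) ≤ j gives (1).

open import Defs
open import Data.Nat using (ℕ; zero; suc; _+_; _∸_; _≤_; _<_; _≤′_; ≤′-refl; ≤′-step; z≤n; s≤s)
open import Data.Nat.Properties
  using (≤-refl; ≤-trans; ≤-antisym; ≤-pred; <-irrefl; <-≤-trans; <⇒≤; _≤?_; ≰⇒>; ≤⇒≤′;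
         ≤-<-connex; n≤1+n; m<n⇒m<1+n; m<1+n⇒m<n∨m≡n; m≤n⇒m<n∨m≡n; m≤m+n; m≤n+m; m<m+n;
         n≤0⇒n≡0; +-suc; +-monoˡ-≤; +-cancelˡ-≤; m≤n+m∸n; m∸n+n≡m; m≤n⇒m∸n≡0; m∸n≢0⇒n<m;
         m≤o∸n⇒m+n≤o)
import Data.Nat.Properties as ℕₚ
open import Data.Integer using (+_)
open import Data.Maybe using (Maybe; just)
open import Data.Fin using (Fin; zero; suc; toℕ; fromℕ<; punchIn; punchOut; _≟_)
open import Data.Fin.Properties
  using (toℕ<n; toℕ-fromℕ<; suc-injective; punchIn-punchOut; all?; ¬∀⟶∃¬)
open import Data.Vec.Functional using (_∷_)
open import Data.Product using (Σ; Σ-syntax; _×_; _,_; proj₁; proj₂)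
open import Data.Sum as Sum using (_⊎_; inj₁; inj₂)
open import Data.Empty using (⊥-elim)
open import Function using (_∘_)
open import Function.Definitions using (Injective)
open import Relation.Nullary using (¬_; yes; no)
open import Relation.Binary.PropositionalEquality as ≡ using (_≡_)

module LinearAlgebra (F : FiniteField) where
  open FiniteField F hiding (zero) renaming (_+_ to _⊕_; _≟_ to _≟F_)
  open import Algebra.Properties.Ring ring
    using (-1*x≈-x; -‿distribˡ-*; -‿distribʳ-*; -‿involutive; -0#≈0#;
           +-inverseˡ-unique; +-inverseʳ-unique; x[y-z]≈xy-xz)
  open import Algebra.Properties.Semiring.Sum semiring
    using (sum; sum-syntax; sum-cong-≋; sum-replicate-zero; ∑-distrib-+; ∑-comm;
           *-distribˡ-sum; *-distribʳ-sum)
  open import Relation.Binary.Reasoning.Setoid setoid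

  ∑≡sum : ∀ n (f : Fin n → Carrier) → ∑ F n f ≡ sum f
  ∑≡sum zero    f = ≡.refl
  ∑≡sum (suc n) f = ≡.cong (f zero ⊕_) (∑≡sum n (f ∘ suc))

  sum-zero : ∀ {n} {f : Fin n → Carrier} → (∀ a → f a ≈ 0#) → sum f ≈ 0#
  sum-zero {n} f≈0 = trans (sum-cong-≋ f≈0) (sum-replicate-zero n)

  -‿sum : ∀ {n} (f : Fin n → Carrier) → - sum f ≈ ∑[ a < n ] (- f a)
  -‿sum f = begin
    - sum f                  ≈⟨ -1*x≈-x _ ⟨
    - 1# * sum f             ≈⟨ *-distribˡ-sum (- 1#) f ⟩
    ∑[ a < _ ] (- 1# * f a)  ≈⟨ sum-cong-≋ (λ a → -1*x≈-x (f a)) ⟩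
    ∑[ a < _ ] (- f a)       ∎

  LinearRelation : ∀ {s j} → Matrix F s j → (Fin s → Carrier) → Set
  LinearRelation {s} u c = ∀ b → ∑[ a < s ] (c a * u a b) ≈ 0#

  Independent : ∀ {s j} → Matrix F s j → Set
  Independent {s} u = ∀ c → LinearRelation u c → ∀ a → c a ≈ 0#

  Dependent : ∀ {s j} → Matrix F s j → Set
  Dependent {s} u = Σ[ c ∈ (Fin s → Carrier) ] (Σ[ a ∈ Fin s ] ¬ c a ≈ 0#) × LinearRelation u c

  independent⇒¬dependent : ∀ {s j} {u : Matrix F s j} → Independent u → ¬ Dependent u
  independent⇒¬dependent ind (c , (a , ca≉0) , rel) = ca≉0 (ind c rel a)

  RowsIndependent⇒Independent : ∀ {i j s} (M : Matrix F i j) (σ : Fin s → Fin i) →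
                                RowsIndependent F M σ → Independent (M ∘ σ)
  RowsIndependent⇒Independent {s = s} M σ ind c rel =
    ind c (λ b → trans (reflexive (∑≡sum s _)) (rel b))

  Independent⇒RowsIndependent : ∀ {i j s} (M : Matrix F i j) (σ : Fin s → Fin i) →
                                Independent (M ∘ σ) → RowsIndependent F M σ
  Independent⇒RowsIndependent {s = s} M σ ind c rel =
    ind c (λ b → trans (reflexive (≡.sym (∑≡sum s _))) (rel b))

  independent-tail : ∀ {s j} (u : Matrix F (suc s) j) → Independent u → Independent (u ∘ suc)
  independent-tail u ind c rel a =
    ind (0# ∷ c) (λ b → trans (+-cong (zeroˡ _) (rel b)) (+-identityˡ 0#)) (suc a)

  independent-cong : ∀ {s j} {u v : Matrix F s j} → (∀ a b → u a b ≈ v a b) →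
                     Independent u → Independent v
  independent-cong u≈v ind c rel =
    ind c (λ b → trans (sum-cong-≋ (λ a → *-congˡ (u≈v a b))) (rel b))

  zero-head⇒dependent : ∀ {s j} (u : Matrix F (suc s) j) → (∀ b → u zero b ≈ 0#) → Dependent u
  zero-head⇒dependent u head≈0 = (1# ∷ λ _ → 0#) , (zero , λ 1≈0 → 0≉1 (sym 1≈0)) , λ b →
    trans (+-cong (trans (*-identityˡ _) (head≈0 b)) (sum-zero (λ a → zeroˡ (u (suc a) b))))
          (+-identityˡ 0#)

  zero-or-nonzero-entry : ∀ {j} (f : Fin j → Carrier) →
                          (∀ b → f b ≈ 0#) ⊎ Σ[ b ∈ Fin j ] ¬ f b ≈ 0#
  zero-or-nonzero-entry {j} f with all? (λ b → f b ≟F 0#)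
  ... | yes f≈0 = inj₁ f≈0
  ... | no f≉0  = inj₂ (¬∀⟶∃¬ j _ (λ b → f b ≟F 0#) f≉0)

  -- Linear relations of v and of eliminated correspond: lifted and restrict-relation are
  -- mutually inverse (up to ≈, by relation-head).
  module Elimination {r j} (v : Matrix F (suc r) j) (q : Fin j) (y : Carrier)
                     (pivot : v zero q * y ≈ 1#) where

    multiplier : Fin r → Carrier
    multiplier a = v (suc a) q * y

    eliminated : Matrix F r j
    eliminated a b = v (suc a) b - multiplier a * v zero b

    eliminated-pivot-column : ∀ a → eliminated a q ≈ 0#
    eliminated-pivot-column a = begin
      v (suc a) q - (v (suc a) q * y) * v zero q  ≈⟨ +-congˡ (-‿cong (*-assoc _ _ _)) ⟩
      v (suc a) q - v (suc a) q * (y * v zero q)  ≈⟨ +-congˡ (-‿cong (*-congˡ (trans (*-comm _ _) pivot))) ⟩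
      v (suc a) q - v (suc a) q * 1#              ≈⟨ +-congˡ (-‿cong (*-identityʳ _)) ⟩
      v (suc a) q - v (suc a) q                   ≈⟨ -‿inverseʳ _ ⟩
      0#                                          ∎

    eliminated-combination : ∀ (c : Fin r → Carrier) b →
      ∑[ a < r ] (c a * eliminated a b)
        ≈ ∑[ a < r ] (c a * v (suc a) b) - ∑[ a < r ] (c a * multiplier a) * v zero b
    eliminated-combination c b = begin
      ∑[ a < r ] (c a * eliminated a b)
        ≈⟨ sum-cong-≋ (λ a → trans (x[y-z]≈xy-xz (c a) _ _)
             (+-congˡ (-‿cong (sym (*-assoc (c a) (multiplier a) (v zero b)))))) ⟩
      ∑[ a < r ] (c a * v (suc a) b - (c a * multiplier a) * v zero b)
        ≈⟨ ∑-distrib-+ (λ a → c a * v (suc a) b) (λ a → - ((c a * multiplier a) * v zero b)) ⟩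
      ∑[ a < r ] (c a * v (suc a) b) ⊕ ∑[ a < r ] (- ((c a * multiplier a) * v zero b))
        ≈⟨ +-congˡ (-‿sum (λ a → (c a * multiplier a) * v zero b)) ⟨
      ∑[ a < r ] (c a * v (suc a) b) - ∑[ a < r ] ((c a * multiplier a) * v zero b)
        ≈⟨ +-congˡ (-‿cong (*-distribʳ-sum (v zero b) (λ a → c a * multiplier a))) ⟨
      ∑[ a < r ] (c a * v (suc a) b) - ∑[ a < r ] (c a * multiplier a) * v zero b
        ∎

    lifted : (Fin r → Carrier) → Fin (suc r) → Carrier
    lifted c = (- ∑[ a < r ] (c a * multiplier a)) ∷ c

    lift-relation : ∀ {c} → LinearRelation eliminated c → LinearRelation v (lifted c)
    lift-relation {c} rel b = begin
      - Q * v zero b ⊕ ∑[ a < r ] (c a * v (suc a) b)  ≈⟨ +-comm _ _ ⟩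
      ∑[ a < r ] (c a * v (suc a) b) ⊕ - Q * v zero b  ≈⟨ +-congˡ (-‿distribˡ-* _ _) ⟨
      ∑[ a < r ] (c a * v (suc a) b) - Q * v zero b    ≈⟨ eliminated-combination c b ⟨
      ∑[ a < r ] (c a * eliminated a b)                ≈⟨ rel b ⟩
      0#                                               ∎
      where
      Q : Carrier
      Q = ∑[ a < r ] (c a * multiplier a)

    independent-eliminated : Independent v → Independent eliminated
    independent-eliminated ind c rel a = ind (lifted c) (lift-relation rel) (suc a)

    dependent-lift : Dependent eliminated → Dependent v
    dependent-lift (c , (a , ca≉0) , rel) = lifted c , (suc a , ca≉0) , lift-relation rel

    relation-head : ∀ {c} → LinearRelation v c → ∑[ a < r ] (c (suc a) * multiplier a) ≈ - c zero
    relation-head {c} rel = begin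
      ∑[ a < r ] (c (suc a) * (v (suc a) q * y))
        ≈⟨ sum-cong-≋ (λ a → *-assoc (c (suc a)) (v (suc a) q) y) ⟨
      ∑[ a < r ] (c (suc a) * v (suc a) q * y)
        ≈⟨ *-distribʳ-sum y (λ a → c (suc a) * v (suc a) q) ⟨
      ∑[ a < r ] (c (suc a) * v (suc a) q) * y
        ≈⟨ *-congʳ (+-inverseʳ-unique _ _ (rel q)) ⟩
      - (c zero * v zero q) * y                    ≈⟨ -‿distribˡ-* _ _ ⟨
      - (c zero * v zero q * y)                    ≈⟨ -‿cong (trans (*-assoc _ _ _) (*-congˡ pivot)) ⟩
      - (c zero * 1#)                              ≈⟨ -‿cong (*-identityʳ (c zero)) ⟩
      - c zero                                     ∎

    restrict-relation : ∀ {c} → LinearRelation v c → LinearRelation eliminated (c ∘ suc)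
    restrict-relation {c} rel b = begin
      ∑[ a < r ] (c (suc a) * eliminated a b)
        ≈⟨ eliminated-combination (c ∘ suc) b ⟩
      ∑[ a < r ] (c (suc a) * v (suc a) b) - ∑[ a < r ] (c (suc a) * multiplier a) * v zero b
        ≈⟨ +-cong (+-inverseʳ-unique _ _ (rel b)) (-‿cong (*-congʳ (relation-head {c} rel))) ⟩
      - (c zero * v zero b) - - c zero * v zero b
        ≈⟨ +-congˡ (-‿cong (-‿distribˡ-* _ _)) ⟨
      - (c zero * v zero b) - - (c zero * v zero b)
        ≈⟨ -‿inverseʳ _ ⟩
      0# ∎

    independent-lift : Independent eliminated → Independent v
    independent-lift ind c rel = λ { zero → c₀≈0 ; (suc a) → tail≈0 a }
      where
      tail≈0 : ∀ a → c (suc a) ≈ 0#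
      tail≈0 = ind (c ∘ suc) (restrict-relation {c} rel)

      c₀≈0 : c zero ≈ 0#
      c₀≈0 = begin
        c zero                                   ≈⟨ -‿involutive (c zero) ⟨
        - - c zero                               ≈⟨ -‿cong (relation-head {c} rel) ⟨
        - ∑[ a < r ] (c (suc a) * multiplier a)
          ≈⟨ -‿cong (sum-zero (λ a → trans (*-congʳ (tail≈0 a)) (zeroˡ _))) ⟩
        - 0#                                     ≈⟨ -0#≈0# ⟩
        0#                                       ∎

  independent? : ∀ {s j} (u : Matrix F s j) → Independent u ⊎ Dependent u
  independent? {zero}  u = inj₁ (λ c rel ())
  independent? {suc s} u with zero-or-nonzero-entry (u zero)
  ... | inj₁ head≈0 = inj₂ (zero-head⇒dependent u head≈0)
  ... | inj₂ (q , u₀q≉0) with inverse (u zero q) u₀q≉0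
  ...   | y , pivot = Sum.map independent-lift dependent-lift (independent? eliminated)
    where open Elimination u q y pivot

  independent-without-column : ∀ {s j} {u : Matrix F s (suc j)} (q : Fin (suc j)) →
    (∀ a → u a q ≈ 0#) → Independent u → Independent (λ a b → u a (punchIn q b))
  independent-without-column {s} {u = u} q column≈0 ind c rel = ind c rel′
    where
    rel′ : LinearRelation u c
    rel′ b with q ≟ b
    ... | yes ≡.refl = sum-zero (λ a → trans (*-congˡ (column≈0 a)) (zeroʳ (c a)))
    ... | no q≢b     = ≡.subst (λ b′ → ∑[ a < s ] (c a * u a b′) ≈ 0#)
                               (punchIn-punchOut q≢b) (rel (punchOut q≢b))

  independent⇒≤ : ∀ {s j} (u : Matrix F s j) → Independent u → s ≤ j
  independent⇒≤ {zero}          u ind = z≤n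
  independent⇒≤ {suc s} {zero}  u ind =
    ⊥-elim (independent⇒¬dependent {u = u} ind (zero-head⇒dependent u λ ()))
  independent⇒≤ {suc s} {suc j} u ind with zero-or-nonzero-entry (u zero)
  ... | inj₁ head≈0 = ⊥-elim (independent⇒¬dependent {u = u} ind (zero-head⇒dependent u head≈0))
  ... | inj₂ (q , u₀q≉0) with inverse (u zero q) u₀q≉0
  ...   | y , pivot = s≤s (independent⇒≤ (λ a b → eliminated a (punchIn q b))
                        (independent-without-column q eliminated-pivot-column (independent-eliminated ind)))
    where open Elimination u q y pivot

  independent-combination⇒≤ : ∀ {s t j} (u : Matrix F s j) (w : Matrix F t j) (C : Matrix F s t) →
    (∀ a b → u a b ≈ ∑[ k < t ] (C a k * w k b)) → Independent u → s ≤ t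
  independent-combination⇒≤ {s} {t} u w C u≈Cw ind =
    independent⇒≤ C (λ c rel → ind c (relation-of-u rel))
    where
    relation-of-u : ∀ {c} → LinearRelation C c → LinearRelation u c
    relation-of-u {c} rel b = begin
      ∑[ a < s ] (c a * u a b)
        ≈⟨ sum-cong-≋ (λ a → *-congˡ (u≈Cw a b)) ⟩
      ∑[ a < s ] (c a * ∑[ k < t ] (C a k * w k b))
        ≈⟨ sum-cong-≋ (λ a → *-distribˡ-sum (c a) (λ k → C a k * w k b)) ⟩
      ∑[ a < s ] ∑[ k < t ] (c a * (C a k * w k b))
        ≈⟨ ∑-comm (λ a k → c a * (C a k * w k b)) ⟩
      ∑[ k < t ] ∑[ a < s ] (c a * (C a k * w k b))
        ≈⟨ sum-cong-≋ (λ k → sum-cong-≋ (λ a → *-assoc (c a) (C a k) (w k b))) ⟨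
      ∑[ k < t ] ∑[ a < s ] (c a * C a k * w k b)
        ≈⟨ sum-cong-≋ (λ k → *-distribʳ-sum (w k b) (λ a → c a * C a k)) ⟨
      ∑[ k < t ] (∑[ a < s ] (c a * C a k) * w k b)
        ≈⟨ sum-zero (λ k → trans (*-congʳ (rel k)) (zeroˡ (w k b))) ⟩
      0# ∎

  dependent⇒head-combination : ∀ {s j} (u : Matrix F (suc s) j) → Independent (u ∘ suc) →
    Dependent u → Σ[ d ∈ (Fin s → Carrier) ] ∀ b → u zero b ≈ ∑[ k < s ] (d k * u (suc k) b)
  dependent⇒head-combination {s} {j} u ind (c , (a₀ , ca₀≉0) , rel) with c zero ≟F 0#
  ... | yes c₀≈0 = ⊥-elim (ca₀≉0 (c≈0 a₀))
    where
    c≈0 : ∀ a → c a ≈ 0#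
    c≈0 zero    = c₀≈0
    c≈0 (suc a) = ind (c ∘ suc) (λ b → trans (sym (+-identityˡ _))
                    (trans (+-congʳ (sym (trans (*-congʳ c₀≈0) (zeroˡ (u zero b))))) (rel b))) a
  ... | no c₀≉0 with inverse (c zero) c₀≉0
  ...   | y , c₀y≈1 = (λ k → - (y * c (suc k))) , λ b → begin
    u zero b                                        ≈⟨ *-identityˡ (u zero b) ⟨
    1# * u zero b                                   ≈⟨ *-congʳ (trans (*-comm y (c zero)) c₀y≈1) ⟨
    y * c zero * u zero b                           ≈⟨ *-assoc y (c zero) (u zero b) ⟩
    y * (c zero * u zero b)                         ≈⟨ *-congˡ (+-inverseˡ-unique _ _ (rel b)) ⟩
    y * - T b                                       ≈⟨ -‿distribʳ-* y (T b) ⟨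
    - (y * T b)
      ≈⟨ -‿cong (*-distribˡ-sum y (λ k → c (suc k) * u (suc k) b)) ⟩
    - ∑[ k < s ] (y * (c (suc k) * u (suc k) b))
      ≈⟨ -‿sum (λ k → y * (c (suc k) * u (suc k) b)) ⟩
    ∑[ k < s ] (- (y * (c (suc k) * u (suc k) b)))
      ≈⟨ sum-cong-≋ (λ k → trans (-‿cong (sym (*-assoc _ _ _))) (-‿distribˡ-* (y * c (suc k)) _)) ⟩
    ∑[ k < s ] (- (y * c (suc k)) * u (suc k) b)    ∎
    where
    T : Fin j → Carrier
    T b = ∑[ k < s ] (c (suc k) * u (suc k) b)

  independent-subfamily : ∀ {i j s t} (M : Matrix F i j) → s ≤′ t → (σ : Fin t → Fin i) →
    Injective _≡_ _≡_ σ → Independent (M ∘ σ) →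
    Σ[ τ ∈ (Fin s → Fin i) ] Injective _≡_ _≡_ τ × Independent (M ∘ τ)
  independent-subfamily M ≤′-refl        σ σ-inj σ-ind = σ , σ-inj , σ-ind
  independent-subfamily M (≤′-step s≤t) σ σ-inj σ-ind = independent-subfamily M s≤t (σ ∘ suc)
    (λ eq → suc-injective (σ-inj eq)) (independent-tail (M ∘ σ) σ-ind)

  independent-rows≤rank : ∀ {i j r t} (M : Matrix F i j) → HasRank F M r → (σ : Fin t → Fin i) →
    Injective _≡_ _≡_ σ → Independent (M ∘ σ) → t ≤ r
  independent-rows≤rank {r = r} {t} M (_ , maximal) σ σ-inj σ-ind with t ≤? r
  ... | yes t≤r = t≤r
  ... | no  t≰r with independent-subfamily M (≤⇒≤′ (≰⇒> t≰r)) σ σ-inj σ-ind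
  ...   | τ , τ-inj , τ-ind = ⊥-elim (maximal τ τ-inj (Independent⇒RowsIndependent M τ τ-ind))

  HasRank-unique : ∀ {i j r s} (M : Matrix F i j) → HasRank F M r → HasRank F M s → r ≡ s
  HasRank-unique M hr@((σ , σ-inj , σ-ind) , _) hs@((τ , τ-inj , τ-ind) , _) =
    ≤-antisym (independent-rows≤rank M hs σ σ-inj (RowsIndependent⇒Independent M σ σ-ind))
              (independent-rows≤rank M hr τ τ-inj (RowsIndependent⇒Independent M τ τ-ind))

module CornerRank (F : FiniteField) (R : ℕ → ℕ → FiniteField.Carrier F) where
  open FiniteField F
    using (Carrier; _≈_; 0#; 1#; _*_; _-_; refl; sym; trans; reflexive; +-cong; +-congʳ; *-congˡ;
           +-identityˡ; +-identityʳ; *-identityˡ; *-identityʳ; zeroˡ; zeroʳ; semiring; +-group)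
    renaming (_+_ to _⊕_)
  open LinearAlgebra F
  open import Algebra.Properties.Semiring.Sum semiring using (sum-syntax)
  open import Algebra.Properties.Group +-group using (//-rightDividesˡ)

  Corner : (i j : ℕ) → Matrix F i j
  Corner i j a b = R (toℕ a) (toℕ b)

  Rows : ∀ {s} → (Fin s → ℕ) → (j : ℕ) → Matrix F s j
  Rows rows j a b = R (rows a) (toℕ b)

  -- Vectors are infinite rows ℕ → Carrier compared on their first j entries, so that one
  -- family can span corners of different widths.
  InSpan : ∀ {t} → (Fin t → ℕ → Carrier) → (j x : ℕ) → Set
  InSpan {t} W j x = Σ[ C ∈ (Fin t → Carrier) ] ∀ b → b < j → R x b ≈ ∑[ k < t ] (C k * W k b)

  Spans : ∀ {t} → (Fin t → ℕ → Carrier) → (i j : ℕ) → Set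
  Spans W i j = ∀ x → x < i → InSpan W j x

  InSpan-∷ : ∀ {t j x} {W : Fin t → ℕ → Carrier} (V : ℕ → Carrier) →
             InSpan W j x → InSpan (V ∷ W) j x
  InSpan-∷ V (C , x≈CW) = (0# ∷ C) , λ b b<j →
    trans (x≈CW b b<j) (sym (trans (+-congʳ (zeroˡ (V b))) (+-identityˡ _)))

  InSpan-head : ∀ {t j x} (W : Fin t → ℕ → Carrier) → InSpan (R x ∷ W) j x
  InSpan-head {x = x} W = (1# ∷ λ _ → 0#) , λ b b<j →
    sym (trans (+-cong (*-identityˡ (R x b)) (sum-zero (λ k → zeroˡ (W k b)))) (+-identityʳ (R x b)))

  Spans-∷-row : ∀ {t i j} {W : Fin t → ℕ → Carrier} → Spans W i j → Spans (R i ∷ W) (suc i) j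
  Spans-∷-row {i = i} {W = W} spans x x<1+i with m<1+n⇒m<n∨m≡n x<1+i
  ... | inj₁ x<i    = InSpan-∷ (R i) (spans x x<i)
  ... | inj₂ ≡.refl = InSpan-head W

  Spans-extend-rows : ∀ d {t i j} {W : Fin t → ℕ → Carrier} → Spans W i j →
                      Σ[ W′ ∈ (Fin (d + t) → ℕ → Carrier) ] Spans W′ (d + i) j
  Spans-extend-rows zero    spans = _ , spans
  Spans-extend-rows (suc d) {i = i} spans =
    let W′ , spans′ = Spans-extend-rows d spans in R (d + i) ∷ W′ , Spans-∷-row spans′

  unit : ℕ → ℕ → Carrier
  unit j b with b ℕₚ.≟ j
  ... | yes _ = 1#
  ... | no  _ = 0#

  unit-diagonal : ∀ j → unit j j ≈ 1#
  unit-diagonal j with j ℕₚ.≟ j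
  ... | yes _  = refl
  ... | no j≢j = ⊥-elim (j≢j ≡.refl)

  unit-below : ∀ {j b} → b < j → unit j b ≈ 0#
  unit-below {j} {b} b<j with b ℕₚ.≟ j
  ... | yes b≡j = ⊥-elim (<-irrefl b≡j b<j)
  ... | no  _   = refl

  Spans-∷-column : ∀ {t i j} {W : Fin t → ℕ → Carrier} → Spans W i j →
                   Spans (unit j ∷ W) i (suc j)
  Spans-∷-column {t} {j = j} {W} spans x x<i with spans x x<i
  ... | C , x≈CW = (R x j - CW j) ∷ C , λ b b<1+j → entry b (m<1+n⇒m<n∨m≡n b<1+j)
    where
    CW : ℕ → Carrier
    CW b = ∑[ k < t ] (C k * W k b)

    entry : ∀ b → b < j ⊎ b ≡ j → R x b ≈ (R x j - CW j) * unit j b ⊕ CW b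
    entry b (inj₁ b<j)    = trans (x≈CW b b<j)
      (sym (trans (+-congʳ (trans (*-congˡ (unit-below b<j)) (zeroʳ _))) (+-identityˡ (CW b))))
    entry b (inj₂ ≡.refl) = sym (trans (+-congʳ (trans (*-congˡ (unit-diagonal b)) (*-identityʳ _)))
                                       (//-rightDividesˡ (CW b) (R x b)))

  Spans-extend-columns : ∀ d {t i j} {W : Fin t → ℕ → Carrier} → Spans W i j →
                         Σ[ W′ ∈ (Fin (d + t) → ℕ → Carrier) ] Spans W′ i (d + j)
  Spans-extend-columns zero    spans = _ , spans
  Spans-extend-columns (suc d) {j = j} spans =
    let W′ , spans′ = Spans-extend-columns d spans in unit (d + j) ∷ W′ , Spans-∷-column spans′

  independent≤spanning : ∀ {s t i j J} (rows : Fin s → ℕ) → Independent (Rows rows j) →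
                         (∀ a → rows a < i) → {W : Fin t → ℕ → Carrier} → Spans W i J → j ≤ J → s ≤ t
  independent≤spanning rows independent rows<i {W} spans j≤J =
    independent-combination⇒≤ (Rows rows _) (λ k b → W k (toℕ b))
      (λ a → proj₁ (spans (rows a) (rows<i a)))
      (λ a b → proj₂ (spans (rows a) (rows<i a)) (toℕ b) (<-≤-trans (toℕ<n b) j≤J)) independent

  -- Row indices are kept as naturals below i, so that a basis of the first i rows can be
  -- reused unchanged for the first suc i rows.
  record Basis (i j : ℕ) : Set where
    field
      size           : ℕ
      rows           : Fin size → ℕ
      rows<i         : ∀ a → rows a < i
      rows-injective : Injective _≡_ _≡_ rows
      independent    : Independent (Rows rows j)
      spanning       : Spans (R ∘ rows) i j

  basis-extend : ∀ {i j} (B : Basis i j) → Independent (Rows (i ∷ Basis.rows B) j) → Basis (suc i) j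
  basis-extend {i} B independent′ = record
    { size           = suc size
    ; rows           = i ∷ rows
    ; rows<i         = λ { zero → ≤-refl ; (suc a) → m<n⇒m<1+n (rows<i a) }
    ; rows-injective = injective
    ; independent    = independent′
    ; spanning       = Spans-∷-row spanning
    }
    where
    open Basis B
    injective : Injective _≡_ _≡_ (i ∷ rows)
    injective {zero}  {zero}  _  = ≡.refl
    injective {zero}  {suc b} eq = ⊥-elim (<-irrefl (≡.sym eq) (rows<i b))
    injective {suc a} {zero}  eq = ⊥-elim (<-irrefl eq (rows<i a))
    injective {suc a} {suc b} eq = ≡.cong suc (rows-injective eq)

  basis-keep : ∀ {i j} (B : Basis i j) → Dependent (Rows (i ∷ Basis.rows B) j) → Basis (suc i) j
  basis-keep {i} {j} B dependent = record
    { size           = size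
    ; rows           = rows
    ; rows<i         = λ a → m<n⇒m<1+n (rows<i a)
    ; rows-injective = rows-injective
    ; independent    = independent
    ; spanning       = spanning′
    }
    where
    open Basis B
    spanning′ : Spans (R ∘ rows) (suc i) j
    spanning′ x x<1+i with m<1+n⇒m<n∨m≡n x<1+i
    ... | inj₁ x<i    = spanning x x<i
    ... | inj₂ ≡.refl =
      let d , i≈dW = dependent⇒head-combination (Rows (i ∷ rows) j) independent dependent
      in d , λ b b<j → ≡.subst (λ b′ → R i b′ ≈ ∑[ k < size ] (d k * R (rows k) b′))
                               (toℕ-fromℕ< b<j) (i≈dW (fromℕ< b<j))

  basis : ∀ i j → Basis i j
  basis zero    j = record
    { size = 0 ; rows = λ () ; rows<i = λ () ; rows-injective = λ {}
    ; independent = λ _ _ () ; spanning = λ _ () }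
  basis (suc i) j = Sum.[ basis-extend B , basis-keep B ]′ (independent? (Rows (i ∷ Basis.rows B) j))
    where
    B : Basis i j
    B = basis i j

  rank : ℕ → ℕ → ℕ
  rank i j = Basis.size (basis i j)

  rank-spec : ∀ i j → HasRank F (Corner i j) (rank i j)
  rank-spec i j = (σ , σ-injective , σ-independent) , maximal
    where
    open Basis (basis i j)
    σ : Fin size → Fin i
    σ a = fromℕ< (rows<i a)

    toℕ-σ : ∀ a → toℕ (σ a) ≡ rows a
    toℕ-σ a = toℕ-fromℕ< (rows<i a)

    σ-injective : Injective _≡_ _≡_ σ
    σ-injective {a} {b} eq =
      rows-injective (≡.trans (≡.sym (toℕ-σ a)) (≡.trans (≡.cong toℕ eq) (toℕ-σ b)))

    σ-independent : RowsIndependent F (Corner i j) σ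
    σ-independent = Independent⇒RowsIndependent (Corner i j) σ
      (independent-cong (λ a b → reflexive (≡.cong (λ x → R x (toℕ b)) (≡.sym (toℕ-σ a)))) independent)

    maximal : ∀ τ → Injective _≡_ _≡_ τ → ¬ RowsIndependent F (Corner i j) τ
    maximal τ _ τ-independent = <-irrefl ≡.refl
      (independent≤spanning (toℕ ∘ τ) (RowsIndependent⇒Independent (Corner i j) τ τ-independent)
                            (toℕ<n ∘ τ) spanning ≤-refl)

  rank-unique : ∀ {i j r} → HasRank F (Corner i j) r → r ≡ rank i j
  rank-unique {i} {j} hasRank = HasRank-unique (Corner i j) hasRank (rank-spec i j)

  rank≤columns : ∀ i j → rank i j ≤ j
  rank≤columns i j = independent⇒≤ (Rows rows j) independent
    where open Basis (basis i j)

  rank≤spanning : ∀ {t i i′ j J} {W : Fin t → ℕ → Carrier} → Spans W i′ J → i ≤ i′ → j ≤ J →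
                  rank i j ≤ t
  rank≤spanning {i = i} {j = j} spans i≤i′ j≤J =
    independent≤spanning rows independent (λ a → <-≤-trans (rows<i a) i≤i′) spans j≤J
    where open Basis (basis i j)

  rank-mono-rows : ∀ i j → rank i j ≤ rank (suc i) j
  rank-mono-rows i j = rank≤spanning (Basis.spanning (basis (suc i) j)) (n≤1+n i) ≤-refl

  rank-rows : ∀ i k j → rank i j ≤ (i ∸ k) + rank k j
  rank-rows i k j = rank≤spanning (proj₂ (Spans-extend-rows (i ∸ k) (Basis.spanning (basis k j))))
    (≡.subst (i ≤_) (ℕₚ.+-comm k (i ∸ k)) (m≤n+m∸n i k)) ≤-refl

  rank-columns : ∀ i j k → rank i j ≤ (j ∸ k) + rank i k
  rank-columns i j k = rank≤spanning (proj₂ (Spans-extend-columns (j ∸ k) (Basis.spanning (basis i k))))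
    ≤-refl (≡.subst (j ≤_) (ℕₚ.+-comm k (j ∸ k)) (m≤n+m∸n j k))

least-fixed-point-above : (f : ℕ → ℕ) → (∀ n → f n ≤ f (suc n)) →
  ∀ {a b} → a ≤ b → a < f a → f b ≤ b →
  Σ[ i ∈ ℕ ] f i ≡ i × (∀ k → a ≤ k → k < i → k < f k)
least-fixed-point-above f mono {a} {b} a≤b a<fa fb≤b =
  search (b ∸ a) a<fa (≡.subst (λ n → f n ≤ n) (≡.sym (m∸n+n≡m a≤b)) fb≤b)
  where
  search : ∀ d {a} → a < f a → f (d + a) ≤ d + a →
           Σ[ i ∈ ℕ ] f i ≡ i × (∀ k → a ≤ k → k < i → k < f k)
  search zero    {a} a<fa fa≤a = ⊥-elim (<-irrefl ≡.refl (<-≤-trans a<fa fa≤a))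
  search (suc d) {a} a<fa fb≤b with f (suc a) ≤? suc a
  ... | yes f[1+a]≤1+a = suc a , ≤-antisym f[1+a]≤1+a (≤-trans a<fa (mono a)) , below
    where
    below : ∀ k → a ≤ k → k < suc a → k < f k
    below k a≤k k<1+a with ≤-antisym a≤k (≤-pred k<1+a)
    ... | ≡.refl = a<fa
  ... | no f[1+a]≰1+a
      with search d (≰⇒> f[1+a]≰1+a) (≡.subst (λ n → f n ≤ n) (≡.sym (+-suc d a)) fb≤b)
  ...   | i , fi≡i , below = i , fi≡i , below′
    where
    below′ : ∀ k → a ≤ k → k < i → k < f k
    below′ k a≤k k<i with m≤n⇒m<n∨m≡n a≤k
    ... | inj₁ a<k    = below k a<k k<i
    ... | inj₂ ≡.refl = a<fa

module IndexSequences (F : FiniteField) (θ : Laurent F) where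
  open FiniteField F using (Carrier)
  open ≡ using (refl; sym; trans; cong; subst; subst₂)

  -- With this choice, Corner i j is Δ F θ i j by definition.
  hankel : ℕ → ℕ → Carrier
  hankel x b = Laurent.coeff θ (+ (x + b + 1))

  open CornerRank F hankel public

  RankCond⇒ : ∀ {ℓ i j} → RankCond F θ ℓ i j → rank i j + ℓ ≡ i
  RankCond⇒ {ℓ} (r , i≡r+ℓ , hasRank) = trans (cong (_+ ℓ) (sym (rank-unique hasRank))) (sym i≡r+ℓ)

  RankCond⇐ : ∀ {ℓ i j} → rank i j + ℓ ≡ i → RankCond F θ ℓ i j
  RankCond⇐ {i = i} {j} rank+ℓ≡i = rank i j , sym rank+ℓ≡i , rank-spec i j

  IsMinJ⇒full-rank : ∀ {i j} → IsMinJ F θ i j → rank i j ≡ i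
  IsMinJ⇒full-rank (_ , full , _) = sym (rank-unique full)

  previous-step : ∀ {ℓ m i j} {jₘ : Maybe ℕ} → Reach F θ ℓ m i jₘ → IsMinJ F θ i j →
                  Σ[ n ∈ ℕ ] jₘ ≡ just n × rank i n + ℓ ≡ i
  previous-step {ℓ} base _                   = 0 , refl , cong (_+ ℓ) (n≤0⇒n≡0 (rank≤columns ℓ 0))
  previous-step (fin _ _ (_ , cond , _)) _   = _ , refl , RankCond⇒ cond
  previous-step (inf _ noJ) (1≤j , full , _) = ⊥-elim (noJ _ 1≤j full)

  j-gap : ∀ {ℓ i n j} → 0 < ℓ → rank i n + ℓ ≡ i → rank i j ≡ i → n + ℓ ≤ j
  j-gap {ℓ} {i} {n} {j} 0<ℓ previous full = subst (_≤ j) (ℕₚ.+-comm ℓ n) (m≤o∸n⇒m+n≤o ℓ n≤j ℓ≤j∸n)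
    where
    r : ℕ
    r = rank i n

    ℓ≤j∸n : ℓ ≤ j ∸ n
    ℓ≤j∸n = +-cancelˡ-≤ r ℓ (j ∸ n)
      (subst₂ _≤_ (trans full (sym previous)) (ℕₚ.+-comm (j ∸ n) r) (rank-columns i j n))

    n≤j : n ≤ j
    n≤j = <⇒≤ (m∸n≢0⇒n<m (λ j∸n≡0 → <-irrefl refl (<-≤-trans 0<ℓ (subst (ℓ ≤_) j∸n≡0 ℓ≤j∸n))))

  i-gap : ∀ {ℓ i j k} → 0 < ℓ → rank i j ≡ i → rank k j + ℓ ≡ k → i + ℓ ≤ k
  i-gap {ℓ} {i} {j} {k} 0<ℓ full cond = by-cases (≤-<-connex k i)
    where
    r : ℕ
    r = rank k j

    i≤ : i ≤ (i ∸ k) + r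
    i≤ = subst (_≤ (i ∸ k) + r) full (rank-rows i k j)

    by-cases : k ≤ i ⊎ i < k → i + ℓ ≤ k
    by-cases (inj₁ k≤i) = ⊥-elim (<-irrefl refl (<-≤-trans (m<m+n r 0<ℓ) (subst (_≤ r) (sym cond) k≤r)))
      where
      k≤r : k ≤ r
      k≤r = +-cancelˡ-≤ (i ∸ k) k r (subst (_≤ (i ∸ k) + r) (sym (m∸n+n≡m k≤i)) i≤)
    by-cases (inj₂ i<k) =
      subst (i + ℓ ≤_) cond (+-monoˡ-≤ ℓ (subst (λ d → i ≤ d + r) (m≤n⇒m∸n≡0 (<⇒≤ i<k)) i≤))

  least-rank-fixed-point : ∀ {ℓ i j} → 0 < ℓ → rank i j ≡ i →
    Σ[ i′ ∈ ℕ ] rank i′ j + ℓ ≡ i′ × (∀ k → i ≤ k → k < i′ → k < rank k j + ℓ)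
  least-rank-fixed-point {ℓ} {i} {j} 0<ℓ full =
    least-fixed-point-above f (λ k → +-monoˡ-≤ ℓ (rank-mono-rows k j)) i≤j+ℓ i<fi fj+ℓ≤j+ℓ
    where
    f : ℕ → ℕ
    f k = rank k j + ℓ

    i≤j+ℓ : i ≤ j + ℓ
    i≤j+ℓ = ≤-trans (subst (_≤ j) full (rank≤columns i j)) (m≤m+n j ℓ)

    i<fi : i < f i
    i<fi = subst (λ r → i < r + ℓ) (sym full) (m<m+n i 0<ℓ)

    fj+ℓ≤j+ℓ : f (j + ℓ) ≤ j + ℓ
    fj+ℓ≤j+ℓ = +-monoˡ-≤ ℓ (rank≤columns (j + ℓ) j)

  next-i : ∀ {ℓ i j} → 0 < ℓ → rank i j ≡ i →
           Σ[ i′ ∈ ℕ ] IsMinI F θ ℓ j i′ × i′ ≤ j + ℓ × i + ℓ ≤ i′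
  next-i {ℓ} {i} {j} 0<ℓ full with least-rank-fixed-point 0<ℓ full
  ... | i′ , fixed , below = i′ , (1≤i′ , RankCond⇐ fixed , minimal) , i′≤j+ℓ , i+ℓ≤i′
    where
    i+ℓ≤i′ : i + ℓ ≤ i′
    i+ℓ≤i′ = i-gap 0<ℓ full fixed

    1≤i′ : 1 ≤ i′
    1≤i′ = ≤-trans 0<ℓ (≤-trans (m≤n+m ℓ i) i+ℓ≤i′)

    i′≤j+ℓ : i′ ≤ j + ℓ
    i′≤j+ℓ = subst (_≤ j + ℓ) fixed (+-monoˡ-≤ ℓ (rank≤columns i′ j))

    minimal : ∀ k → 1 ≤ k → k < i′ → ¬ RankCond F θ ℓ k j
    minimal k _ k<i′ cond = <-irrefl (sym fk≡k) (below k (≤-trans (m≤m+n i ℓ) (i-gap 0<ℓ full fk≡k)) k<i′)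
      where
      fk≡k : rank k j + ℓ ≡ k
      fk≡k = RankCond⇒ cond

lemma3p2 : (F : FiniteField) (θ : Laurent F) (ℓ : ℕ) → 0 < ℓ →
    (m iₘ : ℕ) (jₘ : Maybe ℕ) → Reach F θ ℓ m iₘ jₘ →
    (j' : ℕ) → IsMinJ F θ iₘ j' →
    Σ ℕ λ i' → IsMinI F θ ℓ j' i'
      × i' ≤ j' + ℓ
      × iₘ + ℓ ≤ i'
      × Σ ℕ λ n → jₘ ≡ just n × n + ℓ ≤ j'
lemma3p2 F θ ℓ 0<ℓ m iₘ jₘ reach j' isMinJ =
  let i' , isMinI , i'≤j'+ℓ , iₘ+ℓ≤i' = next-i 0<ℓ full
      n , jₘ≡n , previous = previous-step reach isMinJ
  in i' , isMinI , i'≤j'+ℓ , iₘ+ℓ≤i' , n , jₘ≡n , j-gap 0<ℓ previous full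
  where
  open IndexSequences F θ
  full : rank iₘ j' ≡ iₘ
  full = IsMinJ⇒full-rank isMinJ
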